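{- Let $n\ge1$ and let $\lambda$ be a partition with $1\le|\lambda|\le n+1$. For any container diagram $\sigma\in\mathcal{OP}_{n,\lambda}$ that has at least one empty box, there exists $\gamma\in\mathcal{OP}_{n,\lambda}$ that has exactly one empty box such that $\mathsf{code}(\gamma)_i\le\mathsf{code}(\sigma)_i$ for all $i\in[n]$.
   Context: For a partition $\lambda$ with conjugate $\lambda'$, consider the Young diagram of $\lambda'$ (row $i$, counted from the top, has boxes in columns $1,\dots,\lambda'_i$; column $c$ has $\lambda_c$ boxes in rows $1,\dots,\lambda_c$), columns indexed by all positive integers. A container diagram of $(n,\lambda)$ is a placement of each of $1,\dots,n$ exactly once, either in a box or floating above row 1 in some column, such that each box has at most one number, numbers strictly decrease from top to bottom in each column (floating numbers being above all boxes), and an empty box has no number above it in its column. Equivalently: an ordered sequence $(S_1,S_2,\dots)$ of disjoint sets with union $[n]$, the elements of $S_c$ placed in column $c$ decreasingly from top to bottom with the smallest in row $\lambda_c$, the next in row $\lambda_c-1$, etc., extras floating above and unfilled top boxes empty. $\mathcal{OP}_{n,\lambda}$ is the set of container diagrams. Treating empty boxes as containing $\infty$, $\mathsf{code}(\sigma)$ is the length-$n$ sequence whose $i$-th entry is: if $i$ is in a box in row $r$, column $c$, the number of boxes in row $r$ in columns $>c$ or in row $r+1$ in columns $<c$ containing a number larger than $i$; if $i$ floats in column $c$, $c-1$ plus the number of boxes in row 1 in columns $>c$ containing a number larger than $i$. -}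

module Defs where

open import Data.Nat using (ℕ; zero; suc; _+_; _∸_; _≤_; _<_; _≥_; _<ᵇ_; _≡ᵇ_)
open import Data.Nat.Properties using (_≟_)
open import Data.Bool using (Bool; true; false; _∧_; not; if_then_else_)
open import Data.Fin using (Fin; toℕ)
open import Data.Nat.ListAction using (sum)
open import Data.List using (List; []; _∷_; length; upTo; allFin; filter; map; applyUpTo)
open import Data.List.Relation.Unary.All using (All)
open import Data.List.Relation.Unary.Linked using (Linked)
open import Data.Maybe using (Maybe; just; nothing)

-- A partition: a list (λ₁, …, λ_ℓ) of positive integers, weakly decreasing.
-- Column c (1-based) of the diagram of λ' has λ_c boxes; columns c > ℓ have none.
IsPartition : List ℕ → Set
IsPartition la = All (λ x → 1 ≤ x) la × Linked _≥_ la
  where open import Data.Product using (_×_)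

size : List ℕ → ℕ
size = sum

-- λ_c for 0-based column index c (so column c here is column c+1 of the paper);
-- 0 beyond the length of λ.
part : List ℕ → ℕ → ℕ
part []       _       = 0
part (x ∷ _)  zero    = x
part (_ ∷ xs) (suc c) = part xs c

countB : {A : Set} → (A → Bool) → List A → ℕ
countB f []       = 0
countB f (x ∷ xs) = (if f x then 1 else 0) + countB f xs

-- A container diagram of (n, λ), in the equivalent form of an ordered sequence
-- (S₁, S₂, …) of disjoint sets with union [n]: it is the map sending each number
-- (Fin n, where x : Fin n stands for the number toℕ x + 1; the order is preserved)
-- to the 0-based index of the column S_c containing it.
Diagram : ℕ → Set
Diagram n = Fin n → ℕ

module _ {n : ℕ} (la : List ℕ) (σ : Diagram n) where

  colSize : ℕ → ℕ
  colSize c = countB (λ y → σ y ≡ᵇ c) (allFin n)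

  rank : Fin n → ℕ
  rank x = countB (λ y → (σ y ≡ᵇ σ x) ∧ (toℕ y <ᵇ toℕ x)) (allFin n)

  floats : Fin n → Bool
  floats x = not (rank x <ᵇ part la (σ x))

  -- row (1-based, from the top) of a non-floating x: the smallest element of
  -- column c sits in row λ_c, the next one in row λ_c - 1, etc.
  row : Fin n → ℕ
  row x = part la (σ x) ∸ rank x

  -- contents of box (row r (1-based), column c (0-based)), for 1 ≤ r ≤ λ_c:
  -- the element of S_c sitting in that row, or nothing if the box is empty
  first : List (Fin n) → Maybe (Fin n)
  first []      = nothing
  first (x ∷ _) = just x

  content : ℕ → ℕ → Maybe (Fin n)
  content r c = first (filter (λ x → (σ x ≟ c) ×-dec (rank x ≟ (part la c ∸ r))) (allFin n))
    where open import Relation.Nullary.Decidable using (_×-dec_)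

  isBox : ℕ → ℕ → Bool
  isBox r c = (0 <ᵇ r) ∧ (r <ᵇ suc (part la c))

  -- box (r, c) exists and contains a number larger than i (empty boxes count as ∞)
  largerBox : Fin n → ℕ → ℕ → Bool
  largerBox i r c with isBox r c | content r c
  ... | false | _       = false
  ... | true  | nothing = true
  ... | true  | just x  = toℕ i <ᵇ toℕ x

  cols : List ℕ
  cols = upTo (length la)

  code : Fin n → ℕ
  code i with floats i
  ... | false = countB (λ c → (σ i <ᵇ c) ∧ largerBox i (row i) c) cols
              + countB (λ c → (c <ᵇ σ i) ∧ largerBox i (suc (row i)) c) cols
  ... | true  = σ i   -- (c - 1) for the 1-based column c = σ i + 1
              + countB (λ c → (σ i <ᵇ c) ∧ largerBox i 1 c) cols

  emptyBoxes : ℕ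
  emptyBoxes = sum (map (λ c → countB (λ r → isEmpty (content r c)) (applyUpTo suc (part la c))) cols)
    where
      isEmpty : Maybe (Fin n) → Bool
      isEmpty nothing  = true
      isEmpty (just _) = false

module Submission where

-- Insert 1, …, n into the diagram in increasing order. At every moment the empty boxes of a
-- column d form its top h d boxes, and the code of the next number depends only on the vector h
-- and on the column c it enters: it floats if h c = 0 and otherwise fills row h c.
-- Build γ alongside σ, keeping its vector pointwise below that of σ. A number that σ puts into a
-- box goes to the same column in γ when the two heights agree there, and otherwise into the
-- rightmost tallest column of γ, where its code is 0; a number that floats in σ is likewise
-- promoted into a tallest column of γ, until γ would be left with a single empty box, and floats
-- in the same column after that. Codes never increase. If σ has e empty boxes, it has at least
-- e − 1 floating numbers because |λ| ≤ n + 1, so the promotions do bring γ down to one empty box.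

open import Data.Bool using (Bool; true; false; T; _∧_; not; if_then_else_)
open import Data.Bool.Properties using (T-∧; ∧-zeroʳ; ∧-identityʳ)
open import Data.Fin using (Fin; toℕ; fromℕ<) renaming (zero to fzero; suc to fsuc)
open import Data.Fin.Properties using (toℕ-fromℕ<; toℕ<n; toℕ-injective)
open import Data.List using (List; []; _∷_; length; upTo; allFin; map; applyUpTo; tabulate)
open import Data.List.Membership.Propositional using (_∈_)
open import Data.List.Membership.Propositional.Properties using (∈-allFin; ∈-filter⁺)
open import Data.List.Relation.Unary.All using (All; _∷_)
open import Data.List.Relation.Unary.All.Properties using (all-filter)
open import Data.Maybe using (just; nothing)
open import Data.Nat using (ℕ; zero; suc; _+_; _∸_; _≤_; _<_; _<ᵇ_; _≡ᵇ_; _≤ᵇ_; z≤n; s≤s; z<s)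
open import Data.Nat.ListAction using (sum)
open import Data.Nat.Properties
open import Data.Product using (Σ; ∃-syntax; _×_; _,_; proj₁; proj₂)
open import Data.Sum using (_⊎_; inj₁; inj₂; [_,_]′)
open import Function using (_∘_; case_of_; Equivalence)
open import Relation.Binary.Definitions using (tri<; tri≈; tri>)
open import Relation.Binary.PropositionalEquality
open import Relation.Nullary using (¬_; yes; no; Dec; does; contradiction)
open import Relation.Nullary.Decidable using (_×-dec_; dec-true; dec-false)

open import Defs

indicator : Bool → ℕ
indicator b = if b then 1 else 0

does-≡ : {A B : Set} (a? : Dec A) (b? : Dec B) → (A → B) → (B → A) → does a? ≡ does b?
does-≡ a? b? f g with a?
... | yes a = sym (dec-true b? (f a))
... | no ¬a = sym (dec-false b? (¬a ∘ g))

∧-monoʳ-T : ∀ a {b b′} → (T b → T b′) → T (a ∧ b) → T (a ∧ b′)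
∧-monoʳ-T true  b⇒b′ = b⇒b′
∧-monoʳ-T false _    = λ ()

∧-congʳ-T : ∀ a {b b′} → (T a → b ≡ b′) → a ∧ b ≡ a ∧ b′
∧-congʳ-T true  b≡b′ = b≡b′ _
∧-congʳ-T false _    = refl

≤ᵇ-weakenʳ : ∀ {k m n} → m ≤ n → T (k ≤ᵇ m) → T (k ≤ᵇ n)
≤ᵇ-weakenʳ {k} {m} m≤n k≤m = ≤⇒≤ᵇ (≤-trans (≤ᵇ⇒≤ k m k≤m) m≤n)

not-<ᵇ : ∀ m n → not (m <ᵇ n) ≡ (n ∸ m ≡ᵇ 0)
not-<ᵇ zero    zero    = refl
not-<ᵇ zero    (suc n) = refl
not-<ᵇ (suc m) zero    = refl
not-<ᵇ (suc m) (suc n) = not-<ᵇ m n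

n≤o∸m⇒m≤o∸n : ∀ {m n o} → m ≤ o → n ≤ o ∸ m → m ≤ o ∸ n
n≤o∸m⇒m≤o∸n {m} {n} m≤o n≤o∸m =
  m+n≤o⇒m≤o∸n m (≤-trans (≤-reflexive (+-comm m n)) (m≤o∸n⇒m+n≤o n m≤o n≤o∸m))

0<m∸n⇒n≤m : ∀ {m n} → 0 < m ∸ n → n ≤ m
0<m∸n⇒n≤m 0<m∸n = <⇒≤ (m∸n≢0⇒n<m (λ eq → <-irrefl (sym eq) 0<m∸n))

cancel-+1 : ∀ {a b c d} k → a + 1 ≡ c → b + 1 ≡ d → c + k ≡ d → a + k ≡ b
cancel-+1 {a} {b} {c} {d} k a+1≡c b+1≡d c+k≡d = +-cancelʳ-≡ 1 (a + k) b (begin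
  a + k + 1   ≡⟨ +-assoc a k 1 ⟩
  a + (k + 1) ≡⟨ cong (a +_) (+-comm k 1) ⟩
  a + (1 + k) ≡⟨ +-assoc a 1 k ⟨
  a + 1 + k   ≡⟨ cong (_+ k) a+1≡c ⟩
  c + k       ≡⟨ c+k≡d ⟩
  d           ≡⟨ sym b+1≡d ⟩
  b + 1       ∎)
  where open ≡-Reasoning

sumBelow : (ℕ → ℕ) → ℕ → ℕ
sumBelow f zero    = 0
sumBelow f (suc m) = sumBelow f m + f m

countBelow : (ℕ → Bool) → ℕ → ℕ
countBelow P = sumBelow (indicator ∘ P)

sumBelow-suc : ∀ f m → sumBelow f (suc m) ≡ f 0 + sumBelow (f ∘ suc) m
sumBelow-suc f zero    = +-comm 0 (f 0)
sumBelow-suc f (suc m) = trans (cong (_+ f (suc m)) (sumBelow-suc f m)) (+-assoc (f 0) _ _)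

sum-map-applyUpTo : ∀ {A : Set} (h : A → ℕ) (f : ℕ → A) m → sum (map h (applyUpTo f m)) ≡ sumBelow (h ∘ f) m
sum-map-applyUpTo h f zero    = refl
sum-map-applyUpTo h f (suc m) =
  trans (cong (h (f 0) +_) (sum-map-applyUpTo h (f ∘ suc) m)) (sym (sumBelow-suc (h ∘ f) m))

countB-applyUpTo : ∀ {A : Set} (P : A → Bool) (f : ℕ → A) m → countB P (applyUpTo f m) ≡ countBelow (P ∘ f) m
countB-applyUpTo P f zero    = refl
countB-applyUpTo P f (suc m) =
  trans (cong (indicator (P (f 0)) +_) (countB-applyUpTo P (f ∘ suc) m))
        (sym (sumBelow-suc (indicator ∘ P ∘ f) m))

sumBelow-cong : ∀ {f g} m → (∀ {j} → j < m → f j ≡ g j) → sumBelow f m ≡ sumBelow g m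
sumBelow-cong zero    f≡g = refl
sumBelow-cong (suc m) f≡g = cong₂ _+_ (sumBelow-cong m (f≡g ∘ m<n⇒m<1+n)) (f≡g ≤-refl)

sumBelow-mono : ∀ {f g} m → (∀ {j} → j < m → f j ≤ g j) → sumBelow f m ≤ sumBelow g m
sumBelow-mono zero    f≤g = z≤n
sumBelow-mono (suc m) f≤g = +-mono-≤ (sumBelow-mono m (f≤g ∘ m<n⇒m<1+n)) (f≤g ≤-refl)

sumBelow-monoʳ : ∀ f {m m′} → m ≤ m′ → sumBelow f m ≤ sumBelow f m′
sumBelow-monoʳ f {m} {zero}   z≤n = z≤n
sumBelow-monoʳ f {m} {suc m′} m≤1+m′ with m≤n⇒m<n∨m≡n m≤1+m′
... | inj₁ m<1+m′ = ≤-trans (sumBelow-monoʳ f (≤-pred m<1+m′)) (m≤m+n _ _)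
... | inj₂ refl   = ≤-refl

sumBelow-zero : ∀ {f} m → (∀ {j} → j < m → f j ≡ 0) → sumBelow f m ≡ 0
sumBelow-zero zero    f≡0 = refl
sumBelow-zero (suc m) f≡0 = cong₂ _+_ (sumBelow-zero m (f≡0 ∘ m<n⇒m<1+n)) (f≡0 ≤-refl)

indicator-mono : ∀ {a b} → (T a → T b) → indicator a ≤ indicator b
indicator-mono {true}  {true}  _ = ≤-refl
indicator-mono {true}  {false} f = contradiction _ f
indicator-mono {false}         _ = z≤n

countBelow-mono : ∀ {P Q} m → (∀ {j} → j < m → T (P j) → T (Q j)) → countBelow P m ≤ countBelow Q m
countBelow-mono m P⇒Q = sumBelow-mono m (indicator-mono ∘ P⇒Q)

countBelow-none : ∀ {P} m → (∀ {j} → j < m → ¬ T (P j)) → countBelow P m ≡ 0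
countBelow-none m ¬P = sumBelow-zero m (indicator-false ∘ ¬P)
  where
  indicator-false : ∀ {b} → ¬ T b → indicator b ≡ 0
  indicator-false {true}  ¬b = contradiction _ ¬b
  indicator-false {false} _  = refl

countBelow-true : ∀ m → countBelow (λ _ → true) m ≡ m
countBelow-true zero    = refl
countBelow-true (suc m) = trans (cong (_+ 1) (countBelow-true m)) (+-comm m 1)

countBelow-restrict : ∀ P {m k} → m ≤ k → countBelow (λ j → P j ∧ (j <ᵇ m)) k ≡ countBelow P m
countBelow-restrict P {m} {zero}  z≤n    = refl
countBelow-restrict P {m} {suc k} m≤1+k with m≤n⇒m<n∨m≡n m≤1+k
... | inj₁ m<1+k = trans (cong₂ _+_ (countBelow-restrict P m≤k) (cong indicator k-excluded)) (+-identityʳ _)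
  where
  m≤k = ≤-pred m<1+k
  k-excluded : P k ∧ (k <ᵇ m) ≡ false
  k-excluded = trans (cong (P k ∧_) (dec-false (k <? m) (≤⇒≯ m≤k))) (∧-zeroʳ (P k))
... | inj₂ refl = sumBelow-cong (suc k) λ {j} j<m →
  cong indicator (trans (cong (P j ∧_) (dec-true (j <? suc k) j<m)) (∧-identityʳ (P j)))

countBelow-attains : ∀ P {i k} → k < countBelow P i → ∃[ j ] j < i × T (P j) × countBelow P j ≡ k
countBelow-attains P {suc i} {k} k<count with k <? countBelow P i | P i in Pi
... | yes k<count′ | _ = let j , j<i , Pj , count≡k = countBelow-attains P k<count′ in j , m<n⇒m<1+n j<i , Pj , count≡k
... | no  k≮count′ | true  = i , ≤-refl , subst T (sym Pi) _ ,
  ≤-antisym (≮⇒≥ k≮count′) (≤-pred (≤-trans k<count (≤-reflexive (+-comm (countBelow P i) 1))))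
... | no  k≮count′ | false = contradiction (subst (k <_) (+-identityʳ _) k<count) k≮count′

extend : {A : Set} → A → {n : ℕ} → (Fin n → A) → ℕ → A
extend a {zero}  f j       = a
extend a {suc n} f zero    = f fzero
extend a {suc n} f (suc j) = extend a (f ∘ fsuc) j

extend-toℕ : {A : Set} (a : A) {n : ℕ} (f : Fin n → A) (x : Fin n) → extend a f (toℕ x) ≡ f x
extend-toℕ a f fzero    = refl
extend-toℕ a f (fsuc x) = extend-toℕ a (f ∘ fsuc) x

extend-fromℕ< : {A : Set} (a : A) {n : ℕ} (f : Fin n → A) {j : ℕ} (j<n : j < n) → extend a f j ≡ f (fromℕ< j<n)
extend-fromℕ< a {suc n} f {zero}  _         = refl
extend-fromℕ< a {suc n} f {suc j} (s≤s j<n) = extend-fromℕ< a (f ∘ fsuc) j<n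

countB-tabulate : ∀ {A : Set} {n} (P : A → Bool) (f : Fin n → A) → countB P (tabulate f) ≡ countBelow (extend false (P ∘ f)) n
countB-tabulate {n = zero}  P f = refl
countB-tabulate {n = suc n} P f =
  trans (cong (indicator (P (f fzero)) +_) (countB-tabulate P (f ∘ fsuc)))
        (sym (sumBelow-suc (indicator ∘ extend false (P ∘ f)) n))

part-beyond : ∀ la {c} → length la ≤ c → part la c ≡ 0
part-beyond []                     _         = refl
part-beyond (_ ∷ la) {suc c} (s≤s ℓ≤c) = part-beyond la ℓ≤c

part-pos⇒< : ∀ la {c} → 0 < part la c → c < length la
part-pos⇒< la {c} 0<part with c <? length la
... | yes c<ℓ = c<ℓ
... | no  c≮ℓ = contradiction (part-beyond la (≮⇒≥ c≮ℓ)) (λ eq → <-irrefl (sym eq) 0<part)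

sumBelow-part : ∀ la → sumBelow (part la) (length la) ≡ size la
sumBelow-part []       = refl
sumBelow-part (x ∷ la) = trans (sumBelow-suc (part (x ∷ la)) (length la)) (cong (x +_) (sumBelow-part la))

-- Codes read off vacancy vectors

lowerAt : (ℕ → ℕ) → ℕ → ℕ → ℕ
lowerAt h c d with c ≟ d
... | yes _ = h d ∸ 1
... | no  _ = h d

lowerAt-≤ : ∀ h c d → lowerAt h c d ≤ h d
lowerAt-≤ h c d with c ≟ d
... | yes _ = m∸n≤m (h d) 1
... | no  _ = ≤-refl

lowerAt-mono : ∀ {g h : ℕ → ℕ} c d → g d ≤ h d → lowerAt g c d ≤ lowerAt h c d
lowerAt-mono c d g≤h with c ≟ d
... | yes _ = ∸-monoˡ-≤ 1 g≤h
... | no  _ = g≤h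

lowerAt-below : ∀ {g h : ℕ → ℕ} c d → g d ≤ h d → g c < h c → g d ≤ lowerAt h c d
lowerAt-below {g} {h} c d gd≤hd gc<hc with c ≟ d
... | yes refl = m+n≤o⇒m≤o∸n (g c) {1} (≤-trans (≤-reflexive (+-comm (g c) 1)) gc<hc)
... | no  _    = gd≤hd

lowerAt-cong : ∀ {g h : ℕ → ℕ} c d → g d ≡ h d → lowerAt g c d ≡ lowerAt h c d
lowerAt-cong c d gd≡hd with c ≟ d
... | yes _ = cong (_∸ 1) gd≡hd
... | no  _ = gd≡hd

lowerAt-self : ∀ h c → lowerAt h c c ≡ h c ∸ 1
lowerAt-self h c with c ≟ c
... | yes _   = refl
... | no  c≢c = contradiction refl c≢c

lowerAt-≢ : ∀ h {c d} → c ≢ d → lowerAt h c d ≡ h d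
lowerAt-≢ h {c} {d} c≢d with c ≟ d
... | yes c≡d = contradiction c≡d c≢d
... | no  _   = refl

lowerAt-zero : ∀ h c d → h c ≡ 0 → lowerAt h c d ≡ h d
lowerAt-zero h c d hc≡0 with c ≟ d
... | yes refl = trans (cong (_∸ 1) hc≡0) (sym hc≡0)
... | no  _    = refl

sumBelow-lowerAt : ∀ h {c} m → c < m → 0 < h c → sumBelow (lowerAt h c) m + 1 ≡ sumBelow h m
sumBelow-lowerAt h {c} (suc m) c<1+m 0<hc with m≤n⇒m<n∨m≡n (≤-pred c<1+m)
... | inj₂ refl = begin
  sumBelow (lowerAt h c) c + lowerAt h c c + 1 ≡⟨ cong₂ (λ s x → s + x + 1) lower-sum≡ (lowerAt-self h c) ⟩
  sumBelow h c + (h c ∸ 1) + 1                 ≡⟨ +-assoc (sumBelow h c) _ 1 ⟩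
  sumBelow h c + (h c ∸ 1 + 1)                 ≡⟨ cong (sumBelow h c +_) (m∸n+n≡m 0<hc) ⟩
  sumBelow h c + h c                           ∎
  where
  open ≡-Reasoning
  lower-sum≡ = sumBelow-cong c λ d<c → lowerAt-≢ h (>⇒≢ d<c)
... | inj₁ c<m = begin
  sumBelow (lowerAt h c) m + lowerAt h c m + 1 ≡⟨ cong (λ x → sumBelow (lowerAt h c) m + x + 1) (lowerAt-≢ h (<⇒≢ c<m)) ⟩
  sumBelow (lowerAt h c) m + h m + 1           ≡⟨ +-assoc _ (h m) 1 ⟩
  sumBelow (lowerAt h c) m + (h m + 1)         ≡⟨ cong (sumBelow (lowerAt h c) m +_) (+-comm (h m) 1) ⟩
  sumBelow (lowerAt h c) m + (1 + h m)         ≡⟨ +-assoc _ 1 (h m) ⟨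
  sumBelow (lowerAt h c) m + 1 + h m           ≡⟨ cong (_+ h m) (sumBelow-lowerAt h m c<m 0<hc) ⟩
  sumBelow h m + h m                           ∎
  where open ≡-Reasoning

-- The code of a number entering column c when the top h d boxes of each column d are empty:
-- a box (r, d) with d ≠ c holds a larger number or is empty iff r ≤ h d.
floatingCode : ℕ → (ℕ → ℕ) → ℕ → ℕ
floatingCode L h c = c + countBelow (λ d → (c <ᵇ d) ∧ (1 ≤ᵇ h d)) L

boxedCode : ℕ → (ℕ → ℕ) → ℕ → ℕ
boxedCode L h c = countBelow (λ d → (c <ᵇ d) ∧ (h c ≤ᵇ h d)) L
                + countBelow (λ d → (d <ᵇ c) ∧ (suc (h c) ≤ᵇ h d)) L

heightCode : ℕ → (ℕ → ℕ) → ℕ → ℕ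
heightCode L h c = if h c ≡ᵇ 0 then floatingCode L h c else boxedCode L h c

heightCode-floating : ∀ L h c → h c ≡ 0 → heightCode L h c ≡ floatingCode L h c
heightCode-floating L h c hc≡0 =
  cong (λ b → if b then floatingCode L h c else boxedCode L h c) (dec-true (h c ≟ 0) hc≡0)

heightCode-boxed : ∀ L h c → 0 < h c → heightCode L h c ≡ boxedCode L h c
heightCode-boxed L h c 0<hc =
  cong (λ b → if b then floatingCode L h c else boxedCode L h c) (dec-false (h c ≟ 0) (>⇒≢ 0<hc))

floatingCode-mono : ∀ L {g h : ℕ → ℕ} c → (∀ d → g d ≤ h d) → floatingCode L g c ≤ floatingCode L h c
floatingCode-mono L c g≤h =
  +-monoʳ-≤ c (countBelow-mono L λ {d} _ → ∧-monoʳ-T (c <ᵇ d) (≤ᵇ-weakenʳ (g≤h d)))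

boxedCode-mono : ∀ L {g h : ℕ → ℕ} c → (∀ d → g d ≤ h d) → g c ≡ h c → boxedCode L g c ≤ boxedCode L h c
boxedCode-mono L {g} {h} c g≤h gc≡hc = +-mono-≤
  (countBelow-mono L λ {d} _ → ∧-monoʳ-T (c <ᵇ d) (subst (λ x → T (x ≤ᵇ h d)) gc≡hc ∘ ≤ᵇ-weakenʳ {g c} (g≤h d)))
  (countBelow-mono L λ {d} _ → ∧-monoʳ-T (d <ᵇ c) (subst (λ x → T (suc x ≤ᵇ h d)) gc≡hc ∘ ≤ᵇ-weakenʳ {suc (g c)} (g≤h d)))

heightCode-mono : ∀ L {g h : ℕ → ℕ} c → (∀ d → g d ≤ h d) → g c ≡ h c → heightCode L g c ≤ heightCode L h c
heightCode-mono L {g} {h} c g≤h gc≡hc with h c ≟ 0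
... | yes hc≡0 = begin
  heightCode L g c   ≡⟨ heightCode-floating L g c (trans gc≡hc hc≡0) ⟩
  floatingCode L g c ≤⟨ floatingCode-mono L c g≤h ⟩
  floatingCode L h c ≡⟨ heightCode-floating L h c hc≡0 ⟨
  heightCode L h c   ∎
  where open ≤-Reasoning
... | no hc≢0 = begin
  heightCode L g c ≡⟨ heightCode-boxed L g c (subst (0 <_) (sym gc≡hc) (n≢0⇒n>0 hc≢0)) ⟩
  boxedCode L g c  ≤⟨ boxedCode-mono L c g≤h gc≡hc ⟩
  boxedCode L h c  ≡⟨ heightCode-boxed L h c (n≢0⇒n>0 hc≢0) ⟨
  heightCode L h c ∎
  where open ≤-Reasoning

tallest : (ℕ → ℕ) → ℕ → ℕ
tallest h zero    = 0
tallest h (suc m) with h (tallest h m) ≤? h m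
... | yes _ = m
... | no  _ = tallest h m

tallest-maximal : ∀ (h : ℕ → ℕ) {m c} → c < m → h c ≤ h (tallest h m)
tallest-maximal h {suc m} c<1+m with h (tallest h m) ≤? h m | m≤n⇒m<n∨m≡n (≤-pred c<1+m)
... | yes t≤m | inj₁ c<m = ≤-trans (tallest-maximal h c<m) t≤m
... | yes _   | inj₂ refl = ≤-refl
... | no  _   | inj₁ c<m = tallest-maximal h c<m
... | no  t≰m | inj₂ refl = <⇒≤ (≰⇒> t≰m)

tallest-rightmost : ∀ (h : ℕ → ℕ) {m c} → tallest h m < c → c < m → h c < h (tallest h m)
tallest-rightmost h {suc m} t<c c<1+m with h (tallest h m) ≤? h m | m≤n⇒m<n∨m≡n (≤-pred c<1+m)
... | yes _   | inj₁ c<m = contradiction c<m (<⇒≯ t<c)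
... | yes _   | inj₂ refl = contradiction t<c (<-irrefl refl)
... | no  _   | inj₁ c<m = tallest-rightmost h t<c c<m
... | no  t≰m | inj₂ refl = ≰⇒> t≰m

tallest<suc : ∀ (h : ℕ → ℕ) m → tallest h (suc m) < suc m
tallest<suc h m with h (tallest h m) ≤? h m
... | yes _ = ≤-refl
tallest<suc h zero    | no _ = ≤-refl
tallest<suc h (suc m) | no _ = m<n⇒m<1+n (tallest<suc h m)

tallest-pos : ∀ (h : ℕ → ℕ) m → 0 < sumBelow h m → 0 < h (tallest h m)
tallest-pos h m 0<sum with h (tallest h m) ≟ 0
... | no  ht≢0 = n≢0⇒n>0 ht≢0
... | yes ht≡0 = contradiction (sumBelow-zero m λ c<m → n≤0⇒n≡0 (subst (h _ ≤_) ht≡0 (tallest-maximal h c<m))) (>⇒≢ 0<sum)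

tallest< : ∀ (h : ℕ → ℕ) m → 0 < sumBelow h m → tallest h m < m
tallest< h (suc m) _ = tallest<suc h m

boxedCode-tallest : ∀ L (h : ℕ → ℕ) → boxedCode L h (tallest h L) ≡ 0
boxedCode-tallest L h = cong₂ _+_
  (countBelow-none L λ {d} d<L holds → let t<d , ht≤hd = Equivalence.to T-∧ holds in
     <⇒≱ (tallest-rightmost h (<ᵇ⇒< t d t<d) d<L) (≤ᵇ⇒≤ (h t) (h d) ht≤hd))
  (countBelow-none L λ {d} d<L holds → let _ , ht<hd = Equivalence.to T-∧ holds in
     <⇒≱ (≤ᵇ⇒≤ (suc (h t)) (h d) ht<hd) (tallest-maximal h d<L))
  where t = tallest h L

heightCode-tallest : ∀ L (h : ℕ → ℕ) → 0 < h (tallest h L) → heightCode L h (tallest h L) ≡ 0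
heightCode-tallest L h 0<ht = trans (heightCode-boxed L h (tallest h L) 0<ht) (boxedCode-tallest L h)

-- Vacancies of a diagram

-- The numbers below i placed in column c fill its bottom `placed c i` boxes, so the top
-- `vacant i c` boxes are still empty and i enters row `vacant i (τ i)`, floating if that is 0.
-- `column j` is a junk 0 for j ≥ n; it is only used below n.
module Vacancies (la : List ℕ) {n : ℕ} (τ : Diagram n) where

  L : ℕ
  L = length la

  column : ℕ → ℕ
  column = extend 0 τ

  placed : ℕ → ℕ → ℕ
  placed c = countBelow (λ j → does (column j ≟ c))

  vacant : ℕ → ℕ → ℕ
  vacant i c = part la c ∸ placed c i

  column-toℕ : ∀ x → column (toℕ x) ≡ τ x
  column-toℕ = extend-toℕ 0 τ

  column-fromℕ< : ∀ {j} (j<n : j < n) → column j ≡ τ (fromℕ< j<n)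
  column-fromℕ< = extend-fromℕ< 0 τ

  vacant-suc : ∀ i d → vacant (suc i) d ≡ lowerAt (vacant i) (column i) d
  vacant-suc i d with column i ≟ d
  ... | yes c≡d = trans (cong (λ b → part la d ∸ (placed d i + indicator b)) (dec-true (column i ≟ d) c≡d))
                        (sym (∸-+-assoc (part la d) (placed d i) 1))
  ... | no  c≢d = trans (cong (λ b → part la d ∸ (placed d i + indicator b)) (dec-false (column i ≟ d) c≢d))
                        (cong (part la d ∸_) (+-identityʳ (placed d i)))

  placed-mono : ∀ c {i j} → i ≤ j → placed c i ≤ placed c j
  placed-mono c = sumBelow-monoʳ _

  placed-suc : ∀ {c} x → τ x ≡ c → placed c (suc (toℕ x)) ≡ suc (placed c (toℕ x))
  placed-suc x refl = trans (cong (λ b → placed (τ x) (toℕ x) + indicator b) (dec-true (column (toℕ x) ≟ τ x) (column-toℕ x)))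
                       (+-comm _ 1)

  placed<placed-all : ∀ {c} x → τ x ≡ c → placed c (toℕ x) < placed c n
  placed<placed-all {c} x τx≡c = ≤-trans (≤-reflexive (sym (placed-suc x τx≡c))) (placed-mono c (toℕ<n x))

  placed-attained : ∀ c {i k} → i ≤ n → k < placed c i → ∃[ y ] τ y ≡ c × placed c (toℕ y) ≡ k
  placed-attained c i≤n k<placed =
    let j , j<i , column-j , placed≡k = countBelow-attains _ k<placed
        j<n = <-≤-trans j<i i≤n
    in fromℕ< j<n , trans (sym (column-fromℕ< j<n)) (≡ᵇ⇒≡ _ _ column-j)
                  , trans (cong (placed c) (toℕ-fromℕ< j<n)) placed≡k

  rank≡placed : ∀ x → rank la τ x ≡ placed (τ x) (toℕ x)
  rank≡placed x = begin
    rank la τ x                                                         ≡⟨ countB-tabulate (λ y → (τ y ≡ᵇ τ x) ∧ (toℕ y <ᵇ toℕ x)) (λ y → y) ⟩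
    countBelow (extend false (λ y → (τ y ≡ᵇ τ x) ∧ (toℕ y <ᵇ toℕ x))) n ≡⟨ sumBelow-cong n (cong indicator ∘ pointwise) ⟩
    countBelow (λ j → does (column j ≟ τ x) ∧ (j <ᵇ toℕ x)) n           ≡⟨ countBelow-restrict _ (<⇒≤ (toℕ<n x)) ⟩
    placed (τ x) (toℕ x)                                                ∎
    where
    open ≡-Reasoning
    pointwise : ∀ {j} (j<n : j < n) → extend false (λ y → (τ y ≡ᵇ τ x) ∧ (toℕ y <ᵇ toℕ x)) j ≡ (column j ≡ᵇ τ x) ∧ (j <ᵇ toℕ x)
    pointwise j<n = trans (extend-fromℕ< false _ j<n)
      (cong₂ (λ a b → (a ≡ᵇ τ x) ∧ (b <ᵇ toℕ x)) (sym (column-fromℕ< j<n)) (toℕ-fromℕ< j<n))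

  first-just : ∀ {P : Fin n → Set} {xs x} → All P xs → first la τ xs ≡ just x → P x
  first-just (px ∷ _) refl = px

  first-nothing : ∀ {xs} → first la τ xs ≡ nothing → xs ≡ []
  first-nothing {[]} _ = refl

  Holds : ℕ → ℕ → Fin n → Set
  Holds r c x = τ x ≡ c × rank la τ x ≡ part la c ∸ r

  content-just : ∀ r c {x} → content la τ r c ≡ just x → τ x ≡ c × placed c (toℕ x) ≡ part la c ∸ r
  content-just r c {x} eq =
    let τx≡c , rank≡ = first-just {Holds r c} (all-filter (λ y → (τ y ≟ c) ×-dec (rank la τ y ≟ (part la c ∸ r))) (allFin n)) eq
    in τx≡c , trans (subst (λ c′ → placed c′ (toℕ x) ≡ rank la τ x) τx≡c (sym (rank≡placed x))) rank≡

  content-nothing : ∀ r c → content la τ r c ≡ nothing → placed c n ≤ part la c ∸ r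
  content-nothing r c eq with placed c n ≤? part la c ∸ r
  ... | yes fits = fits
  ... | no  ¬fits =
    let y , τy≡c , placed≡ = placed-attained c ≤-refl (≰⇒> ¬fits)
        y-holds : Holds r c y
        y-holds = τy≡c , trans (rank≡placed y) (trans (cong (λ c′ → placed c′ (toℕ y)) τy≡c) placed≡)
    in case subst (y ∈_) (first-nothing eq) (∈-filter⁺ (λ y → (τ y ≟ c) ×-dec (rank la τ y ≟ (part la c ∸ r))) (∈-allFin y) y-holds) of λ ()

  largerBox-vacant : ∀ i c {r} → c ≢ τ i → 0 < r → largerBox la τ i r c ≡ (r ≤ᵇ vacant (toℕ i) c)
  largerBox-vacant i c {suc r} c≢τi _ with isBox la τ (suc r) c in box? | content la τ (suc r) c in eq
  ... | false | _ = sym (dec-false (suc r ≤? vacant (toℕ i) c) λ r≤v →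
          subst T box? (≤⇒≤ᵇ (≤-trans r≤v (m∸n≤m (part la c) (placed c (toℕ i))))))
  ... | true | nothing = sym (dec-true (suc r ≤? vacant (toℕ i) c)
          (n≤o∸m⇒m≤o∸n r≤part (≤-trans (placed-mono c (<⇒≤ (toℕ<n i))) (content-nothing (suc r) c eq))))
    where r≤part = ≤ᵇ⇒≤ (suc r) (part la c) (subst T (sym box?) _)
  ... | true | just x = does-≡ (toℕ i <? toℕ x) (suc r ≤? vacant (toℕ i) c) before⇒fits fits⇒before
    where
    r≤part = ≤ᵇ⇒≤ (suc r) (part la c) (subst T (sym box?) _)
    τx≡c = proj₁ (content-just (suc r) c eq)
    placed-x = proj₂ (content-just (suc r) c eq)
    before⇒fits : toℕ i < toℕ x → suc r ≤ vacant (toℕ i) c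
    before⇒fits i<x = n≤o∸m⇒m≤o∸n r≤part (≤-trans (placed-mono c (<⇒≤ i<x)) (≤-reflexive placed-x))
    fits⇒before : suc r ≤ vacant (toℕ i) c → toℕ i < toℕ x
    fits⇒before r≤v with <-cmp (toℕ i) (toℕ x)
    ... | tri< i<x _ _ = i<x
    ... | tri≈ _ i≡x _ = contradiction (trans (sym τx≡c) (cong τ (toℕ-injective (sym i≡x)))) c≢τi
    ... | tri> _ _ x<i = contradiction (n≤o∸m⇒m≤o∸n (0<m∸n⇒n≤m (≤-trans (s≤s z≤n) r≤v)) r≤v) (<⇒≱ placed-x<placed-i)
      where
      placed-x<placed-i : part la c ∸ suc r < placed c (toℕ i)
      placed-x<placed-i = begin-strict
        part la c ∸ suc r          ≡⟨ placed-x ⟨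
        placed c (toℕ x)           <⟨ ≤-reflexive (sym (placed-suc x τx≡c)) ⟩
        placed c (suc (toℕ x))     ≤⟨ placed-mono c x<i ⟩
        placed c (toℕ i)           ∎
        where open ≤-Reasoning

  countB-largerBox : ∀ i r (A : ℕ → Bool) → (∀ {c} → T (A c) → c ≢ τ i) → 0 < r →
    countB (λ c → A c ∧ largerBox la τ i r c) (upTo L) ≡ countBelow (λ c → A c ∧ (r ≤ᵇ vacant (toℕ i) c)) L
  countB-largerBox i r A A⇒≢ 0<r = trans (countB-applyUpTo _ (λ c → c) L)
    (sumBelow-cong L λ {c} _ → cong indicator (∧-congʳ-T (A c) λ a → largerBox-vacant i c (A⇒≢ a) 0<r))

  module _ (i : Fin n) where

    private
      v : ℕ → ℕ
      v = vacant (toℕ i)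

      row≡ : row la τ i ≡ v (τ i)
      row≡ = cong (part la (τ i) ∸_) (rank≡placed i)

      floats≡ : floats la τ i ≡ (v (τ i) ≡ᵇ 0)
      floats≡ = trans (cong (λ k → not (k <ᵇ part la (τ i))) (rank≡placed i)) (not-<ᵇ (placed (τ i) (toℕ i)) (part la (τ i)))

      after≢ : ∀ {c} → T (τ i <ᵇ c) → c ≢ τ i
      after≢ {c} τi<c c≡τi = <-irrefl (sym c≡τi) (<ᵇ⇒< (τ i) c τi<c)

      before≢ : ∀ {c} → T (c <ᵇ τ i) → c ≢ τ i
      before≢ {c} c<τi c≡τi = <-irrefl c≡τi (<ᵇ⇒< c (τ i) c<τi)

    code≡heightCode : code la τ i ≡ heightCode L (vacant (toℕ i)) (τ i)
    code≡heightCode with floats la τ i | floats≡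
    ... | true  | floats = begin
      τ i + countB (λ c → (τ i <ᵇ c) ∧ largerBox la τ i 1 c) (upTo L) ≡⟨ cong (τ i +_) (countB-largerBox i 1 _ after≢ z<s) ⟩
      floatingCode L v (τ i)                                        ≡⟨ heightCode-floating L v (τ i) (≡ᵇ⇒≡ _ _ (subst T floats _)) ⟨
      heightCode L v (τ i)                                          ∎
      where open ≡-Reasoning
    ... | false | floats = begin
      countB (λ c → (τ i <ᵇ c) ∧ largerBox la τ i (row la τ i) c) (upTo L)
        + countB (λ c → (c <ᵇ τ i) ∧ largerBox la τ i (suc (row la τ i)) c) (upTo L)
          ≡⟨ cong₂ _+_ (countB-largerBox i _ _ after≢ 0<row) (countB-largerBox i _ _ before≢ z<s) ⟩
      countBelow (λ c → (τ i <ᵇ c) ∧ (row la τ i ≤ᵇ v c)) L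
        + countBelow (λ c → (c <ᵇ τ i) ∧ (suc (row la τ i) ≤ᵇ v c)) L
          ≡⟨ cong (λ r → countBelow (λ c → (τ i <ᵇ c) ∧ (r ≤ᵇ v c)) L + countBelow (λ c → (c <ᵇ τ i) ∧ (suc r ≤ᵇ v c)) L) row≡ ⟩
      boxedCode L v (τ i)
          ≡⟨ heightCode-boxed L v (τ i) 0<v ⟨
      heightCode L v (τ i) ∎
      where
      open ≡-Reasoning
      0<v : 0 < v (τ i)
      0<v = n≢0⇒n>0 λ v≡0 → contradiction (trans floats (dec-true (v (τ i) ≟ 0) v≡0)) λ ()
      0<row = subst (0 <_) (sym row≡) 0<v

  -- The emptiness test used by `emptyBoxes` is local to its definition; this exposes it
  -- as a function of the box, so that it can be related to `content`.
  emptyBoxes-unfolded : Σ (ℕ → ℕ → Bool) λ isEmpty →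
    emptyBoxes la τ ≡ sum (map (λ c → countB (λ r → isEmpty r c) (applyUpTo suc (part la c))) (upTo L))
  emptyBoxes-unfolded = _ , refl

  isEmpty : ℕ → ℕ → Bool
  isEmpty = proj₁ emptyBoxes-unfolded

  isEmpty-box : ∀ c {j} → j < part la c → isEmpty (suc j) c ≡ (j <ᵇ vacant n c)
  isEmpty-box c {j} j<part with content la τ (suc j) c in eq
  ... | nothing = sym (dec-true (j <? vacant n c) (n≤o∸m⇒m≤o∸n j<part (content-nothing (suc j) c eq)))
  ... | just x  = sym (dec-false (j <? vacant n c) λ j<v →
    <⇒≱ (holder<placed) (n≤o∸m⇒m≤o∸n (0<m∸n⇒n≤m (≤-trans (s≤s z≤n) j<v)) j<v))
    where
    holder<placed : part la c ∸ suc j < placed c n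
    holder<placed = let τx≡c , placed-x = content-just (suc j) c eq
                    in subst (_< placed c n) placed-x (placed<placed-all x τx≡c)

  emptyBoxes≡ : emptyBoxes la τ ≡ sumBelow (vacant n) L
  emptyBoxes≡ = trans (proj₂ emptyBoxes-unfolded) (trans (sum-map-applyUpTo _ (λ c → c) L) (sumBelow-cong L λ {c} _ → column-count c))
    where
    column-count : ∀ c → countB (λ r → isEmpty r c) (applyUpTo suc (part la c)) ≡ vacant n c
    column-count c = begin
      countB (λ r → isEmpty r c) (applyUpTo suc (part la c))   ≡⟨ countB-applyUpTo _ suc (part la c) ⟩
      countBelow (λ j → isEmpty (suc j) c) (part la c)        ≡⟨ sumBelow-cong (part la c) (cong indicator ∘ isEmpty-box c) ⟩
      countBelow (λ j → true ∧ (j <ᵇ vacant n c)) (part la c) ≡⟨ countBelow-restrict (λ _ → true) (m∸n≤m (part la c) (placed c n)) ⟩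
      countBelow (λ _ → true) (vacant n c)                    ≡⟨ countBelow-true (vacant n c) ⟩
      vacant n c                                              ∎
      where open ≡-Reasoning

-- The greedy construction

module Greedy (n : ℕ) (la : List ℕ) (σ : Diagram n) where

  open Vacancies la σ using (L; column; placed; vacant; vacant-suc)

  total : ℕ → ℕ
  total m = sumBelow (vacant m) L

  total-suc-≤ : ∀ m → total (suc m) ≤ total m
  total-suc-≤ m = sumBelow-mono L λ {d} _ → ≤-trans (≤-reflexive (vacant-suc m d)) (lowerAt-≤ (vacant m) (column m) d)

  total-antitone : ∀ {m m′} → m ≤ m′ → total m′ ≤ total m
  total-antitone {m} {m′} m≤m′ with m≤n⇒m<n∨m≡n m≤m′
  ... | inj₂ refl = ≤-refl
  total-antitone {m} {suc m′} _ | inj₁ m<1+m′ = ≤-trans (total-suc-≤ m′) (total-antitone (≤-pred m<1+m′))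

  total-suc-floating : ∀ m → vacant m (column m) ≡ 0 → total (suc m) ≡ total m
  total-suc-floating m v≡0 = sumBelow-cong L λ {d} _ → trans (vacant-suc m d) (lowerAt-zero (vacant m) (column m) d v≡0)

  total-suc-boxed : ∀ m → 0 < vacant m (column m) → total (suc m) + 1 ≡ total m
  total-suc-boxed m 0<v = trans (cong (_+ 1) (sumBelow-cong L λ {d} _ → vacant-suc m d))
    (sumBelow-lowerAt (vacant m) L (part-pos⇒< la (≤-trans 0<v (m∸n≤m _ (placed (column m) m)))) 0<v)

  empties : ℕ
  empties = total n

  choose : ℕ → (ℕ → ℕ) → ℕ → ℕ × ℕ
  choose m g k with vacant m (column m) ≟ 0 | 2 + k ≤? empties | g (column m) ≟ vacant m (column m)
  ... | yes _ | yes _ | _     = tallest g L , suc k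
  ... | yes _ | no  _ | _     = column m , k
  ... | no  _ | _     | yes _ = column m , k
  ... | no  _ | _     | no  _ = tallest g L , k

  step : ℕ → (ℕ → ℕ) × ℕ → (ℕ → ℕ) × ℕ
  step m (g , k) = lowerAt g (proj₁ (choose m g k)) , proj₂ (choose m g k)

  run : ℕ → (ℕ → ℕ) × ℕ
  run zero    = part la , 0
  run (suc m) = step m (run m)

  vacancies : ℕ → ℕ → ℕ
  vacancies m = proj₁ (run m)

  promoted : ℕ → ℕ
  promoted m = proj₂ (run m)

  chosen : ℕ → ℕ
  chosen m = proj₁ (choose m (vacancies m) (promoted m))

  γ : Diagram n
  γ = chosen ∘ toℕ

  -- g is the vacancy vector of γ after m steps and k the number of promotions so far.
  -- The first alternative of `saturated` says that every number below m floating in σ was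
  -- promoted: the others fill the size la ∸ total m occupied boxes of σ.
  record Invariant (m : ℕ) (g : ℕ → ℕ) (k : ℕ) : Set where
    field
      dominated : ∀ d → g d ≤ vacant m d
      balance   : sumBelow g L + k ≡ total m
      budget    : suc k ≤ empties
      saturated : k + size la ≡ m + total m ⊎ suc k ≡ empties

  Advances : ℕ → (ℕ → ℕ) → ℕ × ℕ → Set
  Advances m g (c , k′) = Invariant (suc m) (lowerAt g c) k′ × heightCode L g c ≤ heightCode L (vacant m) (column m)

  module _ {m g k} (m<n : m < n) (inv : Invariant m g k) where
    open Invariant inv

    private
      c = column m
      t = tallest g L

    saturated-boxed : 0 < vacant m c → k + size la ≡ m + total m ⊎ suc k ≡ empties →
                      k + size la ≡ suc m + total (suc m) ⊎ suc k ≡ empties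
    saturated-boxed 0<v (inj₁ eq) = inj₁ (begin
      k + size la               ≡⟨ eq ⟩
      m + total m               ≡⟨ cong (m +_) (total-suc-boxed m 0<v) ⟨
      m + (total (suc m) + 1)   ≡⟨ cong (m +_) (+-comm _ 1) ⟩
      m + suc (total (suc m))   ≡⟨ +-suc m _ ⟩
      suc m + total (suc m)     ∎)
      where open ≡-Reasoning
    saturated-boxed _   (inj₂ eq) = inj₂ eq

    dominated-lowerAt : ∀ d → lowerAt g c d ≤ vacant (suc m) d
    dominated-lowerAt d = ≤-trans (lowerAt-mono c d (dominated d)) (≤-reflexive (sym (vacant-suc m d)))

    0<Σg : 0 < sumBelow g L
    0<Σg = +-cancelʳ-≤ k 1 _ (≤-trans budget (≤-trans (total-antitone (<⇒≤ m<n)) (≤-reflexive (sym balance))))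

    drop-tallest : sumBelow (lowerAt g t) L + 1 ≡ sumBelow g L
    drop-tallest = sumBelow-lowerAt g L (tallest< g L 0<Σg) (tallest-pos g L 0<Σg)

    code-tallest : heightCode L g t ≤ heightCode L (vacant m) c
    code-tallest = ≤-trans (≤-reflexive (heightCode-tallest L g (tallest-pos g L 0<Σg))) z≤n

    promote : vacant m c ≡ 0 → 2 + k ≤ empties → Advances m g (t , suc k)
    promote v≡0 room = record
      { dominated = λ d → ≤-trans (lowerAt-≤ g t d) (≤-trans (dominated d)
          (≤-reflexive (sym (trans (vacant-suc m d) (lowerAt-zero (vacant m) c d v≡0)))))
      ; balance   = trans (+-suc _ k) (trans (cong (_+ k) (trans (+-comm 1 _) drop-tallest))
                      (trans balance (sym (total-suc-floating m v≡0))))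
      ; budget    = room
      ; saturated = [ (λ eq → inj₁ (cong suc (trans eq (cong (m +_) (sym (total-suc-floating m v≡0))))))
                    , (λ eq → contradiction (≤-reflexive (sym eq)) (<⇒≱ room)) ]′ saturated
      } , code-tallest

    stay-floating : vacant m c ≡ 0 → ¬ 2 + k ≤ empties → Advances m g (c , k)
    stay-floating v≡0 no-room = record
      { dominated = dominated-lowerAt
      ; balance   = trans (cong (_+ k) (sumBelow-cong L λ {d} _ → lowerAt-zero g c d gc≡0))
                      (trans balance (sym (total-suc-floating m v≡0)))
      ; budget    = budget
      ; saturated = inj₂ (≤-antisym budget (≤-pred (≰⇒> no-room)))
      } , heightCode-mono L c dominated (trans gc≡0 (sym v≡0))
      where gc≡0 = n≤0⇒n≡0 (subst (g c ≤_) v≡0 (dominated c))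

    follow : 0 < vacant m c → g c ≡ vacant m c → Advances m g (c , k)
    follow 0<v gc≡v = record
      { dominated = dominated-lowerAt
      ; balance   = cancel-+1 k (sumBelow-lowerAt g L (part-pos⇒< la (≤-trans 0<v (m∸n≤m _ (placed c m)))) (subst (0 <_) (sym gc≡v) 0<v))
                      (total-suc-boxed m 0<v) balance
      ; budget    = budget
      ; saturated = saturated-boxed 0<v saturated
      } , heightCode-mono L c dominated gc≡v

    jump : 0 < vacant m c → g c ≢ vacant m c → Advances m g (t , k)
    jump 0<v gc≢v = record
      { dominated = λ d → ≤-trans (lowerAt-≤ g t d)
          (≤-trans (lowerAt-below c d (dominated d) (≤∧≢⇒< (dominated c) gc≢v)) (≤-reflexive (sym (vacant-suc m d))))
      ; balance   = cancel-+1 k drop-tallest (total-suc-boxed m 0<v) balance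
      ; budget    = budget
      ; saturated = saturated-boxed 0<v saturated
      } , code-tallest

    choose-advances : Advances m g (choose m g k)
    choose-advances with vacant m c ≟ 0 | 2 + k ≤? empties | g c ≟ vacant m c
    ... | yes v≡0 | yes room    | _        = promote v≡0 room
    ... | yes v≡0 | no  no-room | _        = stay-floating v≡0 no-room
    ... | no  v≢0 | _           | yes gc≡v = follow (n≢0⇒n>0 v≢0) gc≡v
    ... | no  v≢0 | _           | no  gc≢v = jump (n≢0⇒n>0 v≢0) gc≢v

  module _ (1≤empties : 1 ≤ empties) where

    invariant : ∀ m → m ≤ n → Invariant m (vacancies m) (promoted m)
    invariant zero    _     = record
      { dominated = λ _ → ≤-refl
      ; balance   = +-identityʳ _
      ; budget    = 1≤empties
      ; saturated = inj₁ (sym (sumBelow-part la))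
      }
    invariant (suc m) 1+m≤n = proj₁ (choose-advances 1+m≤n (invariant m (<⇒≤ 1+m≤n)))

    module Vγ = Vacancies la γ

    vacant-γ : ∀ m → m ≤ n → ∀ d → Vγ.vacant m d ≡ vacancies m d
    vacant-γ zero    _     d = refl
    vacant-γ (suc m) 1+m≤n d = begin
      Vγ.vacant (suc m) d                          ≡⟨ Vγ.vacant-suc m d ⟩
      lowerAt (Vγ.vacant m) (Vγ.column m) d        ≡⟨ lowerAt-cong (Vγ.column m) d (vacant-γ m (<⇒≤ 1+m≤n) d) ⟩
      lowerAt (vacancies m) (Vγ.column m) d        ≡⟨ cong (λ c → lowerAt (vacancies m) c d) column-γ ⟩
      lowerAt (vacancies m) (chosen m) d           ∎
      where
      open ≡-Reasoning
      column-γ : Vγ.column m ≡ chosen m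
      column-γ = trans (Vγ.column-fromℕ< 1+m≤n) (cong chosen (toℕ-fromℕ< 1+m≤n))

    exhausted : size la ≤ suc n → suc (promoted n) ≡ empties
    exhausted size≤1+n with Invariant.saturated (invariant n ≤-refl)
    ... | inj₂ done = done
    ... | inj₁ eq   = ≤-antisym (Invariant.budget (invariant n ≤-refl)) (+-cancelʳ-≤ n _ _ (begin
      empties + n            ≡⟨ +-comm empties n ⟩
      n + empties            ≡⟨ eq ⟨
      promoted n + size la   ≤⟨ +-monoʳ-≤ (promoted n) size≤1+n ⟩
      promoted n + suc n     ≡⟨ +-suc (promoted n) n ⟩
      suc (promoted n) + n   ∎))
      where open ≤-Reasoning

    one-empty-box : size la ≤ suc n → emptyBoxes la γ ≡ 1
    one-empty-box size≤1+n = begin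
      emptyBoxes la γ            ≡⟨ Vγ.emptyBoxes≡ ⟩
      sumBelow (Vγ.vacant n) L   ≡⟨ sumBelow-cong L (λ {d} _ → vacant-γ n ≤-refl d) ⟩
      sumBelow (vacancies n) L   ≡⟨ +-cancelʳ-≡ (promoted n) _ 1
                                      (trans (Invariant.balance (invariant n ≤-refl)) (sym (exhausted size≤1+n))) ⟩
      1                          ∎
      where open ≡-Reasoning

    code-γ≤code-σ : ∀ i → code la γ i ≤ code la σ i
    code-γ≤code-σ i = begin
      code la γ i                                 ≡⟨ Vγ.code≡heightCode i ⟩
      heightCode L (Vγ.vacant m) (chosen m)       ≤⟨ heightCode-mono L _ (≤-reflexive ∘ vacant-γ m m≤n) (vacant-γ m m≤n _) ⟩
      heightCode L (vacancies m) (chosen m)       ≤⟨ proj₂ (choose-advances (toℕ<n i) (invariant m m≤n)) ⟩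
      heightCode L (vacant m) (column m)          ≡⟨ cong (heightCode L (vacant m)) (Vacancies.column-toℕ la σ i) ⟩
      heightCode L (vacant m) (σ i)               ≡⟨ Vacancies.code≡heightCode la σ i ⟨
      code la σ i                                 ∎
      where
      open ≤-Reasoning
      m = toℕ i
      m≤n = <⇒≤ (toℕ<n i)

lemmaL : (n : ℕ) → 1 ≤ n → (la : List ℕ) → IsPartition la →
         1 ≤ size la → size la ≤ ℕ.suc n →
         (σ : Diagram n) → 1 ≤ emptyBoxes la σ →
         ∃[ γ ] (emptyBoxes la γ ≡ 1 × (∀ (i : Fin n) → code la γ i ≤ code la σ i))
lemmaL n _ la _ _ size≤1+n σ 1≤empty = γ , one-empty-box 1≤empties size≤1+n , code-γ≤code-σ 1≤empties
  where
  open Greedy n la σ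
  1≤empties = subst (1 ≤_) (Vacancies.emptyBoxes≡ la σ) 1≤empty
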